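{- There are no antipodal non-bipartite distance-regular dicirculants with diameter $3$; that is, no Cayley graph on a dicyclic group $\mathrm{Dic}_n$ ($n\ge1$) is an antipodal, non-bipartite distance-regular graph of diameter $3$.
   Context: $\mathrm{Dic}_n=\langle \alpha,\beta \mid \alpha^{2n}=1,\ \beta^2=\alpha^n,\ \beta^{ -1}\alpha\beta=\alpha^{ -1}\rangle$, of order $4n$. For a group $G$ and $S\subseteq G\setminus\{1\}$ with $S=S^{ -1}$, $\mathrm{Cay}(G,S)$ has vertex set $G$, with $g,h$ adjacent iff $g^{ -1}h\in S$. A connected graph of diameter $d$ is distance-regular if for vertices $u,v$ at distance $i$ the numbers of neighbours of $v$ at distance $i-1,i,i+1$ from $u$ depend only on $i$; it is antipodal if the relation "$\partial(u,v)\in\{0,d\}$" is an equivalence relation on vertices. -}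

module Defs where

open import Data.Nat using (ℕ; zero; suc; _+_; _*_; _∸_; _≤_; NonZero)
open import Data.Nat.Properties using (m*n≢0)
open import Data.Nat.DivMod using (_%_; m%n<n)
open import Data.Fin using (Fin; toℕ; fromℕ<)
open import Data.Fin.Properties using (toℕ<n)
open import Data.Bool using (Bool; true; false)
open import Data.Product using (Σ; ∃; _×_; _,_)
open import Data.Sum using (_⊎_)
open import Data.Empty using (⊥)
open import Data.List using (List; length)
open import Data.List.Relation.Unary.Unique.Propositional using (Unique)
open import Data.List.Membership.Propositional using (_∈_)
open import Relation.Binary.PropositionalEquality using (_≡_; _≢_)
open import Relation.Binary.Structures using (IsEquivalence)
open import Relation.Nullary using (¬_)
open import Function.Bundles using (_⇔_)

-- Element (k , b) represents α^k β^b with k ∈ ℤ/2n, b ∈ {0,1}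
-- (false = β^0, true = β^1).  Relations: α^{2n} = 1, β² = α^n,
-- β⁻¹ α β = α⁻¹ (equivalently β α^c = α^{-c} β).

module _ (n : ℕ) .{{_ : NonZero n}} where

  private
    instance
      nz2n : NonZero (2 * n)
      nz2n = m*n≢0 2 n

  Zmod : Set
  Zmod = Fin (2 * n)

  mod : ℕ → Zmod
  mod x = fromℕ< (m%n<n x (2 * n))

  addZ : Zmod → Zmod → Zmod
  addZ a c = mod (toℕ a + toℕ c)

  negZ : Zmod → Zmod
  negZ a = mod (2 * n ∸ toℕ a)

  subZ : Zmod → Zmod → Zmod
  subZ a c = addZ a (negZ c)

  nZ : Zmod
  nZ = mod n

  Dic : Set
  Dic = Zmod × Bool

  one : Dic
  one = mod 0 , false

  -- (α^a β^x)(α^c β^y), using β α^c = α^{-c} β and β² = α^n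
  mul : Dic → Dic → Dic
  mul (a , false) (c , y) = addZ a c , y
  mul (a , true) (c , false) = subZ a c , true
  mul (a , true) (c , true) = addZ (subZ a c) nZ , false

  inv : Dic → Dic
  inv (k , false) = negZ k , false
  inv (k , true) = addZ k nZ , true

  CayAdj : (Dic → Set) → Dic → Dic → Set
  CayAdj S g h = S (mul (inv g) h)

module _ {V : Set} (Adj : V → V → Set) where

  data Walk : V → V → ℕ → Set where
    here : ∀ {u} → Walk u u 0
    step : ∀ {u v w k} → Adj u v → Walk v w k → Walk u w (suc k)

  Dist : V → V → ℕ → Set
  Dist u v i = Walk u v i × (∀ j → Walk u v j → i ≤ j)

  Connected : Set
  Connected = ∀ u v → ∃ λ i → Dist u v i

  HasDiameter : ℕ → Set
  HasDiameter d = Connected × (∀ u v i → Dist u v i → i ≤ d)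
                  × (∃ λ u → ∃ λ v → Dist u v d)

  HasCard : (V → Set) → ℕ → Set
  HasCard P c = Σ (List V) λ xs → Unique xs × length xs ≡ c × (∀ w → (w ∈ xs ⇔ P w))

  DistanceRegular : Set
  DistanceRegular = Connected ×
    (Σ (ℕ → ℕ) λ c → Σ (ℕ → ℕ) λ a → Σ (ℕ → ℕ) λ b →
      ∀ u v i → Dist u v i →
        HasCard (λ w → Adj v w × Dist u w (i ∸ 1) × (1 ≤ i)) (c i) ×
        HasCard (λ w → Adj v w × Dist u w i) (a i) ×
        HasCard (λ w → Adj v w × Dist u w (suc i)) (b i))

  Antipodal : ℕ → Set
  Antipodal d = IsEquivalence (λ u v → Dist u v 0 ⊎ Dist u v d)

  Bipartite : Set
  Bipartite = Σ (V → Bool) λ f → ∀ u v → Adj u v → f u ≢ f v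

{-# OPTIONS --safe #-}

-- Write αⁿ for the central involution (nZ , false) and call the elements (k , true)
-- reflections; every reflection squares to αⁿ.  Connectivity puts a reflection s into S,
-- and ε ~ s ~ αⁿ, so ∂(ε, αⁿ) ≤ 2; antipodality then excludes reflections at distance 3.
-- For a vertex x at distance 1 or 2 from ε, the common neighbours of ε and x (counted by
-- a₁ resp. c₂) carry an involution built from the group law.  For a reflection x it has
-- no fixed point, so a₁ and c₂ are even; for x = u² with u ∈ S a rotation its fixed
-- points are u and possibly uαⁿ, so parity forces uαⁿ ∈ S (when u ≠ αⁿ).  Consequently
-- every neighbour of αⁿ other than ε lies in S: αⁿ has no neighbour at distance ≥ 2 from ε.
-- A geodesic of length 3 shows b₁ > 0 and b₂ > 0, which contradicts this whether
-- ∂(ε, αⁿ) is 1 or 2.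

module Submission where

open import Data.Bool using (Bool; true; false; _xor_)
import Data.Bool as Bool
open import Data.Bool.Properties using (xor-assoc)
open import Data.Empty using (⊥; ⊥-elim)
open import Data.Fin using (toℕ)
import Data.Fin as Fin
open import Data.Fin.Properties using (toℕ-fromℕ<; toℕ-injective; toℕ<n)
open import Data.List using (List; []; _∷_; length; filter)
open import Data.List.Properties using (filter-accept; filter-reject; filter-all)
open import Data.List.Membership.Propositional using (_∈_)
open import Data.List.Membership.Propositional.Properties using (∈-filter⁺; ∈-filter⁻)
import Data.List.Relation.Unary.All as All
open import Data.List.Relation.Unary.AllPairs using (_∷_)
open import Data.List.Relation.Unary.Any using (here; there)
open import Data.List.Relation.Unary.Unique.Propositional using (Unique)
open import Data.List.Relation.Unary.Unique.Propositional.Properties using (filter⁺)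
open import Data.Nat
  using (ℕ; zero; suc; _+_; _*_; _∸_; _≤_; _<_; z≤n; s≤s; NonZero; >-nonZero⁻¹; ≢-nonZero⁻¹)
open import Data.Nat.DivMod using (_%_; m%n<n; %-distribˡ-+; m%n%n≡m%n; n%n≡0; m<n⇒m%n≡m)
open import Data.Nat.Divisibility
  using (_∣_; divides; m%n≡0⇒n∣m; _∣0; ∣-refl; ∣m∣n⇒∣m+n; ∣m+n∣m⇒∣n; ∣1⇒≡1)
open import Data.Nat.Properties
  using ( m*n≢0; m∸n+n≡m; n<1+n; +-comm; +-assoc; +-identityʳ; +-mono-<; +-mono-≤
        ; <⇒≤; <⇒≱; m<m+n; m≤m+n; ≤-refl; ≤-antisym; ≤-pred; *-cancelˡ-≡; m+n≡0⇒m≡0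
        ; suc-injective; 1+n≢n )
open import Data.Product using (_,_; _×_; proj₁; proj₂; ∃; ∃₂)
open import Data.Product.Properties using (≡-dec)
open import Data.Sum using (_⊎_; inj₁; inj₂)
import Data.Sum as Sum
open import Function.Base using (id; _∘_; case_of_)
open import Function.Bundles using (Equivalence; _⇔_; mk⇔)
open import Relation.Binary.Definitions using (DecidableEquality)
open import Relation.Binary.PropositionalEquality
open import Relation.Binary.Structures using (IsEquivalence)
open import Relation.Nullary using (¬_; ¬?; Dec; yes; no)
open import Algebra.Bundles using (AbelianGroup; Group)
open import Algebra.Structures using (IsGroup; IsAbelianGroup)
import Algebra.Properties.AbelianGroup as AbelianGroupProperties
import Algebra.Properties.Group as GroupProperties
import Algebra.Solver.CommutativeMonoid as CommutativeMonoidSolver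

open import Defs

module GraphDistance {V : Set} (Adj : V → V → Set) where

  Walk-length-0 : ∀ {u v} → Walk Adj u v 0 → u ≡ v
  Walk-length-0 here = refl

  Walk-snoc : ∀ {u v w i} → Walk Adj u v i → Adj v w → Walk Adj u w (suc i)
  Walk-snoc here       a = step a here
  Walk-snoc (step b p) a = step b (Walk-snoc p a)

  Dist-functional : ∀ {u v i j} → Dist Adj u v i → Dist Adj u v j → i ≡ j
  Dist-functional (p , p-min) (q , q-min) = ≤-antisym (p-min _ q) (q-min _ p)

  geodesic-prefix : ∀ {u v w i} → Dist Adj u w (suc i) → Walk Adj u v i → Adj v w → Dist Adj u v i
  geodesic-prefix (_ , min) p a = p , λ j q → ≤-pred (min (suc j) (Walk-snoc q a))

  crossing-edge : (colour : V → Bool) → ∀ {u v i} → Walk Adj u v i →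
    colour u ≡ false → colour v ≡ true →
    ∃₂ λ x y → Adj x y × colour x ≡ false × colour y ≡ true
  crossing-edge colour here cu cv with () ← trans (sym cu) cv
  crossing-edge colour (step {v = y} a p) cu cv with colour y in cy
  ... | false = crossing-edge colour p cy cv
  ... | true  = _ , _ , a , cu , cy

  HasCard-inhabited : ∀ {P Q : V → Set} {k y} → HasCard Adj P k → HasCard Adj Q k → P y → ∃ Q
  HasCard-inhabited _ (w ∷ _ , _ , _ , ys⇔Q) _ = w , Equivalence.to (ys⇔Q w) (here refl)
  HasCard-inhabited {y = y} (xs , _ , refl , xs⇔P) ([] , _ , 0≡length , _) Py
    with Equivalence.from (xs⇔P y) Py | 0≡length
  ... | here _  | ()
  ... | there _ | ()

  Walk-map : (f : V → V) → (∀ {u v} → Adj u v → Adj (f u) (f v)) →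
    ∀ {u v i} → Walk Adj u v i → Walk Adj (f u) (f v) i
  Walk-map f f-adj here       = here
  Walk-map f f-adj (step a p) = step (f-adj a) (Walk-map f f-adj p)

  Dist-map : (f g : V → V) → (∀ {u v} → Adj u v → Adj (f u) (f v)) →
    (∀ {u v} → Adj u v → Adj (g u) (g v)) → (∀ v → g (f v) ≡ v) →
    ∀ {u v i} → Dist Adj u v i → Dist Adj (f u) (f v) i
  Dist-map f g f-adj g-adj g∘f {u} {v} (p , min) = Walk-map f f-adj p ,
    λ j q → min j (subst₂ (λ x y → Walk Adj x y j) (g∘f u) (g∘f v) (Walk-map g g-adj q))

module UniqueListRemoval {V : Set} (_≟_ : DecidableEquality V) where

  private
    _≢?_ : ∀ w v → Dec (w ≢ v)
    w ≢? v = ¬? (w ≟ v)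

  without : V → List V → List V
  without v = filter (_≢? v)

  ∈-without⁻ : ∀ {w v xs} → w ∈ without v xs → w ∈ xs × w ≢ v
  ∈-without⁻ {v = v} = ∈-filter⁻ (_≢? v)

  ∈-without⁺ : ∀ {w v xs} → w ∈ xs → w ≢ v → w ∈ without v xs
  ∈-without⁺ {v = v} = ∈-filter⁺ (_≢? v)

  without-Unique : ∀ {v xs} → Unique xs → Unique (without v xs)
  without-Unique {v} = filter⁺ (_≢? v)

  length-without : ∀ {v xs} → Unique xs → v ∈ xs → suc (length (without v xs)) ≡ length xs
  length-without {v} {_ ∷ ys} (v∉ys ∷ _) (here refl) = cong suc (begin
    length (without v (v ∷ ys))  ≡⟨ cong length (filter-reject (_≢? v) (λ v≢v → v≢v refl)) ⟩
    length (without v ys)        ≡⟨ cong length (filter-all (_≢? v) (All.map ≢-sym v∉ys)) ⟩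
    length ys                    ∎)
    where open ≡-Reasoning
  length-without {v} {x ∷ ys} (x∉ys ∷ u) (there v∈ys) = begin
    suc (length (without v (x ∷ ys)))
      ≡⟨ cong (suc ∘ length) (filter-accept (_≢? v) (All.lookup x∉ys v∈ys)) ⟩
    suc (suc (length (without v ys)))
      ≡⟨ cong suc (length-without u v∈ys) ⟩
    suc (length ys)
      ∎
    where open ≡-Reasoning

module InvolutionParity {V : Set} (_≟_ : DecidableEquality V)
  (ι : V → V) (ι-involutive : ∀ v → ι (ι v) ≡ v) where

  open UniqueListRemoval _≟_

  private
    ι-injective : ∀ {v w} → ι v ≡ ι w → v ≡ w
    ι-injective {v} {w} eq = trans (sym (ι-involutive v)) (trans (cong ι eq) (ι-involutive w))

  -- Recursion on the length k: the head x and its partner ι x are removed together.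
  fixedPointFree⇒even : ∀ k {xs} → length xs ≡ k → Unique xs →
    (∀ v → v ∈ xs → ι v ∈ xs) → (∀ v → v ∈ xs → ι v ≢ v) → 2 ∣ k
  fixedPointFree⇒even zero _ _ _ _ = 2 ∣0
  fixedPointFree⇒even (suc k) {x ∷ ys} len (x∉ys ∷ u) closed fpf with closed x (here refl)
  ... | here ιx≡x = ⊥-elim (fpf x (here refl) ιx≡x)
  ... | there ιx∈ys = remove-pair k (trans (length-without u ιx∈ys) (suc-injective len))
    where
    closed′ : ∀ v → v ∈ without (ι x) ys → ι v ∈ without (ι x) ys
    closed′ v v∈ with ∈-without⁻ v∈
    ... | v∈ys , v≢ιx with closed v (there v∈ys)
    ...   | here ιv≡x   = ⊥-elim (v≢ιx (trans (sym (ι-involutive v)) (cong ι ιv≡x)))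
    ...   | there ιv∈ys =
      ∈-without⁺ ιv∈ys (λ ιv≡ιx → All.lookup x∉ys v∈ys (sym (ι-injective ιv≡ιx)))
    fpf′ : ∀ v → v ∈ without (ι x) ys → ι v ≢ v
    fpf′ v v∈ = fpf v (there (proj₁ (∈-without⁻ v∈)))
    remove-pair : ∀ k → suc (length (without (ι x) ys)) ≡ k → 2 ∣ suc k
    remove-pair (suc k′) len′ = ∣m∣n⇒∣m+n (∣-refl {2})
      (fixedPointFree⇒even k′ (suc-injective len′) (without-Unique u) closed′ fpf′)

  uniqueFixedPoint⇒odd : ∀ {xs e} → Unique xs → (∀ v → v ∈ xs → ι v ∈ xs) →
    e ∈ xs → ι e ≡ e → (∀ v → v ∈ xs → ι v ≡ v → v ≡ e) → ¬ 2 ∣ length xs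
  uniqueFixedPoint⇒odd {xs} {e} u closed e∈ ιe≡e fixed 2∣len =
    1+n≢n (∣1⇒≡1 (∣m+n∣m⇒∣n 2∣len+1 2∣rest))
    where
    rest = without e xs
    2∣rest : 2 ∣ length rest
    2∣rest = fixedPointFree⇒even (length rest) refl (without-Unique u)
      (λ v v∈ → let v∈xs , v≢e = ∈-without⁻ v∈ in
        ∈-without⁺ (closed v v∈xs) (λ ιv≡e → v≢e (ι-injective (trans ιv≡e (sym ιe≡e)))))
      (λ v v∈ ιv≡v → let v∈xs , v≢e = ∈-without⁻ v∈ in v≢e (fixed v v∈xs ιv≡v))
    2∣len+1 : 2 ∣ length rest + 1
    2∣len+1 = subst (2 ∣_) (trans (sym (length-without u e∈)) (+-comm 1 (length rest))) 2∣len

  HasCard-even : ∀ {Adj : V → V → Set} {P : V → Set} {c} → HasCard Adj P c →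
    (∀ v → P v → P (ι v)) → (∀ v → P v → ι v ≢ v) → 2 ∣ c
  HasCard-even (xs , u , len , xs⇔P) closed fpf = fixedPointFree⇒even _ len u
    (λ v v∈ → Equivalence.from (xs⇔P (ι v)) (closed v (Equivalence.to (xs⇔P v) v∈)))
    (λ v v∈ → fpf v (Equivalence.to (xs⇔P v) v∈))

  HasCard-odd : ∀ {Adj : V → V → Set} {P : V → Set} {c e} → HasCard Adj P c →
    (∀ v → P v → P (ι v)) → P e → ι e ≡ e → (∀ v → P v → ι v ≡ v → v ≡ e) → ¬ 2 ∣ c
  HasCard-odd (xs , u , refl , xs⇔P) closed Pe ιe≡e fixed = uniqueFixedPoint⇒odd u
    (λ v v∈ → Equivalence.from (xs⇔P (ι v)) (closed v (Equivalence.to (xs⇔P v) v∈)))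
    (Equivalence.from (xs⇔P _) Pe) ιe≡e (λ v v∈ → fixed v (Equivalence.to (xs⇔P v) v∈))

module ℤ/2n (n : ℕ) .{{_ : NonZero n}} where

  private
    N : ℕ
    N = 2 * n

    instance
      N-nonZero : NonZero N
      N-nonZero = m*n≢0 2 n

  toℕ-mod : ∀ x → toℕ (mod n x) ≡ x % N
  toℕ-mod x = toℕ-fromℕ< (m%n<n x N)

  mod-cong : ∀ {x y} → x % N ≡ y % N → mod n x ≡ mod n y
  mod-cong {x} {y} eq = toℕ-injective (trans (toℕ-mod x) (trans eq (sym (toℕ-mod y))))

  mod-toℕ : ∀ a → mod n (toℕ a) ≡ a
  mod-toℕ a = toℕ-injective (trans (toℕ-mod (toℕ a)) (m<n⇒m%n≡m (toℕ<n a)))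

  mod-%+ : ∀ x y → mod n (x % N + y) ≡ mod n (x + y)
  mod-%+ x y = mod-cong (begin
    (x % N + y) % N          ≡⟨ %-distribˡ-+ (x % N) y N ⟩
    (x % N % N + y % N) % N  ≡⟨ cong (λ r → (r + y % N) % N) (m%n%n≡m%n x N) ⟩
    (x % N + y % N) % N      ≡⟨ %-distribˡ-+ x y N ⟨
    (x + y) % N              ∎)
    where open ≡-Reasoning

  mod-+% : ∀ x y → mod n (x + y % N) ≡ mod n (x + y)
  mod-+% x y = begin
    mod n (x + y % N)  ≡⟨ cong (mod n) (+-comm x (y % N)) ⟩
    mod n (y % N + x)  ≡⟨ mod-%+ y x ⟩
    mod n (y + x)      ≡⟨ cong (mod n) (+-comm y x) ⟩
    mod n (x + y)      ∎
    where open ≡-Reasoning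

  addZ-mod : ∀ x y → addZ n (mod n x) (mod n y) ≡ mod n (x + y)
  addZ-mod x y = begin
    mod n (toℕ (mod n x) + toℕ (mod n y))  ≡⟨ cong₂ (λ a b → mod n (a + b)) (toℕ-mod x) (toℕ-mod y) ⟩
    mod n (x % N + y % N)                  ≡⟨ mod-%+ x (y % N) ⟩
    mod n (x + y % N)                      ≡⟨ mod-+% x y ⟩
    mod n (x + y)                          ∎
    where open ≡-Reasoning

  0%N≡0 : 0 % N ≡ 0
  0%N≡0 = m<n⇒m%n≡m (>-nonZero⁻¹ N)

  mod-N : mod n N ≡ mod n 0
  mod-N = mod-cong (trans (n%n≡0 N) (sym 0%N≡0))

  n<N : n < N
  n<N = m<m+n n (subst (0 <_) (sym (+-identityʳ n)) (>-nonZero⁻¹ n))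

  toℕ-nZ : toℕ (nZ n) ≡ n
  toℕ-nZ = trans (toℕ-mod n) (m<n⇒m%n≡m n<N)

  toℕ-0 : toℕ (mod n 0) ≡ 0
  toℕ-0 = trans (toℕ-mod 0) 0%N≡0

  addZ-assoc : ∀ a c e → addZ n (addZ n a c) e ≡ addZ n a (addZ n c e)
  addZ-assoc a c e = begin
    mod n (toℕ (addZ n a c) + E)  ≡⟨ cong (λ r → mod n (r + E)) (toℕ-mod (A + C)) ⟩
    mod n ((A + C) % N + E)       ≡⟨ mod-%+ (A + C) E ⟩
    mod n (A + C + E)             ≡⟨ cong (mod n) (+-assoc A C E) ⟩
    mod n (A + (C + E))           ≡⟨ mod-+% A (C + E) ⟨
    mod n (A + (C + E) % N)       ≡⟨ cong (λ r → mod n (A + r)) (toℕ-mod (C + E)) ⟨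
    mod n (A + toℕ (addZ n c e))  ∎
    where
    open ≡-Reasoning
    A = toℕ a
    C = toℕ c
    E = toℕ e

  addZ-comm : ∀ a c → addZ n a c ≡ addZ n c a
  addZ-comm a c = cong (mod n) (+-comm (toℕ a) (toℕ c))

  addZ-identityˡ : ∀ a → addZ n (mod n 0) a ≡ a
  addZ-identityˡ a = begin
    mod n (toℕ (mod n 0) + toℕ a)  ≡⟨ cong (λ r → mod n (r + toℕ a)) (toℕ-mod 0) ⟩
    mod n (0 % N + toℕ a)          ≡⟨ mod-%+ 0 (toℕ a) ⟩
    mod n (toℕ a)                  ≡⟨ mod-toℕ a ⟩
    a                              ∎
    where open ≡-Reasoning

  negZ-inverseˡ : ∀ a → addZ n (negZ n a) a ≡ mod n 0
  negZ-inverseˡ a = begin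
    mod n (toℕ (negZ n a) + A)  ≡⟨ cong (λ r → mod n (r + A)) (toℕ-mod (N ∸ A)) ⟩
    mod n ((N ∸ A) % N + A)     ≡⟨ mod-%+ (N ∸ A) A ⟩
    mod n (N ∸ A + A)           ≡⟨ cong (mod n) (m∸n+n≡m (<⇒≤ (toℕ<n a))) ⟩
    mod n N                     ≡⟨ mod-N ⟩
    mod n 0                     ∎
    where
    open ≡-Reasoning
    A = toℕ a

  isAbelianGroup : IsAbelianGroup _≡_ (addZ n) (mod n 0) (negZ n)
  isAbelianGroup = record
    { isGroup = record
      { isMonoid = record
        { isSemigroup = record
          { isMagma = record { isEquivalence = isEquivalence ; ∙-cong = cong₂ (addZ n) }
          ; assoc = addZ-assoc
          }
        ; identity = addZ-identityˡ , λ a → trans (addZ-comm a _) (addZ-identityˡ a)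
        }
      ; inverse = negZ-inverseˡ , λ a → trans (addZ-comm a _) (negZ-inverseˡ a)
      ; ⁻¹-cong = cong (negZ n)
      }
    ; comm = addZ-comm
    }

  abelianGroup : AbelianGroup _ _
  abelianGroup = record { isAbelianGroup = isAbelianGroup }

  nZ+nZ≡0 : addZ n (nZ n) (nZ n) ≡ mod n 0
  nZ+nZ≡0 = begin
    addZ n (mod n n) (mod n n)  ≡⟨ addZ-mod n n ⟩
    mod n (n + n)               ≡⟨ cong (λ r → mod n (n + r)) (+-identityʳ n) ⟨
    mod n N                     ≡⟨ mod-N ⟩
    mod n 0                     ∎
    where open ≡-Reasoning

  nZ≢0 : nZ n ≢ mod n 0
  nZ≢0 eq = ≢-nonZero⁻¹ n (trans (sym toℕ-nZ) (trans (cong toℕ eq) toℕ-0))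

  double≡0 : ∀ d → addZ n d d ≡ mod n 0 → d ≡ mod n 0 ⊎ d ≡ nZ n
  double≡0 d eq with m%n≡0⇒n∣m (D + D) N (trans (sym (toℕ-mod (D + D))) (trans (cong toℕ eq) toℕ-0))
    where D = toℕ d
  ... | divides zero D+D≡0 = inj₁ (toℕ-injective (trans (m+n≡0⇒m≡0 (toℕ d) D+D≡0) (sym toℕ-0)))
  ... | divides (suc zero) D+D≡N = inj₂ (toℕ-injective (trans D≡n (sym toℕ-nZ)))
    where
    D≡n : toℕ d ≡ n
    D≡n = *-cancelˡ-≡ (toℕ d) n 2
            (trans (cong (toℕ d +_) (+-identityʳ (toℕ d))) (trans D+D≡N (+-identityʳ N)))
  ... | divides (suc (suc k)) D+D≡kN = ⊥-elim (<⇒≱ (+-mono-< (toℕ<n d) (toℕ<n d))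
          (subst (N + N ≤_) (sym D+D≡kN) (+-mono-≤ (≤-refl {N}) (m≤m+n N (k * N)))))

module Dicyclic (n : ℕ) .{{_ : NonZero n}} where

  open ℤ/2n n
  open AbelianGroup abelianGroup
    using () renaming (_∙_ to _⊕_; _⁻¹ to ⊖_; ε to 0ᶻ; comm to ⊕-comm;
                       identityʳ to ⊕-identityʳ; inverseˡ to ⊖-inverseˡ; inverseʳ to ⊖-inverseʳ)
  open AbelianGroupProperties abelianGroup
    using (⁻¹-∙-comm; ⁻¹-involutive; ε⁻¹≈ε; inverseʳ-unique; //-rightDividesˡ)
  open CommutativeMonoidSolver (AbelianGroup.commutativeMonoid abelianGroup)
    using (solve; _⊜_) renaming (_⊕_ to _⊞_)

  infixl 7 _·_

  _·_ : Dic n → Dic n → Dic n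
  _·_ = mul n

  -- Dic_n is the extension of C₂ by ℤ/2n with action twist and 2-cocycle carry.
  twist : Bool → Zmod n → Zmod n
  twist false c = c
  twist true  c = ⊖ c

  carry : Bool → Bool → Zmod n
  carry true true = nZ n
  carry _    _    = 0ᶻ

  ⊖nZ≡nZ : ⊖ nZ n ≡ nZ n
  ⊖nZ≡nZ = sym (inverseʳ-unique (nZ n) (nZ n) nZ+nZ≡0)

  mul-coords : ∀ a c x y → (a , x) · (c , y) ≡ ((a ⊕ twist x c) ⊕ carry x y , x xor y)
  mul-coords a c false y     = cong (_, y) (sym (⊕-identityʳ _))
  mul-coords a c true  false = cong (_, true) (sym (⊕-identityʳ _))
  mul-coords a c true  true  = refl

  twist-homo : ∀ x a c → twist x (a ⊕ c) ≡ twist x a ⊕ twist x c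
  twist-homo false a c = refl
  twist-homo true  a c = sym (⁻¹-∙-comm a c)

  twist-xor : ∀ x y c → twist x (twist y c) ≡ twist (x xor y) c
  twist-xor false y     c = refl
  twist-xor true  false c = refl
  twist-xor true  true  c = ⁻¹-involutive c

  twist-carry : ∀ x y w → twist x (carry y w) ≡ carry y w
  twist-carry false y     w     = refl
  twist-carry true  true  true  = ⊖nZ≡nZ
  twist-carry true  true  false = ε⁻¹≈ε
  twist-carry true  false w     = ε⁻¹≈ε

  carry-cocycle : ∀ x y w → carry x y ⊕ carry (x xor y) w ≡ carry y w ⊕ carry x (y xor w)
  carry-cocycle true  true  true  = refl
  carry-cocycle true  true  false = ⊕-comm (nZ n) 0ᶻ
  carry-cocycle true  false true  = refl
  carry-cocycle true  false false = refl
  carry-cocycle false true  true  = ⊕-comm 0ᶻ (nZ n)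
  carry-cocycle false true  false = refl
  carry-cocycle false false w     = refl

  mul-assoc : ∀ g h k → (g · h) · k ≡ g · (h · k)
  mul-assoc (a , x) (c , y) (e , w) = begin
    ((a , x) · (c , y)) · (e , w)
      ≡⟨ cong (_· (e , w)) (mul-coords a c x y) ⟩
    (A , x xor y) · (e , w)
      ≡⟨ mul-coords A e (x xor y) w ⟩
    ((A ⊕ twist (x xor y) e) ⊕ carry (x xor y) w , (x xor y) xor w)
      ≡⟨ cong₂ _,_ first-coords (xor-assoc x y w) ⟩
    ((a ⊕ twist x C) ⊕ carry x (y xor w) , x xor (y xor w))
      ≡⟨ mul-coords a C x (y xor w) ⟨
    (a , x) · (C , y xor w)
      ≡⟨ cong ((a , x) ·_) (mul-coords c e y w) ⟨
    (a , x) · ((c , y) · (e , w))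
      ∎
    where
    open ≡-Reasoning
    A = (a ⊕ twist x c) ⊕ carry x y
    C = (c ⊕ twist y e) ⊕ carry y w
    twist-C : twist x C ≡ (twist x c ⊕ twist (x xor y) e) ⊕ carry y w
    twist-C = begin
      twist x C
        ≡⟨ twist-homo x _ _ ⟩
      twist x (c ⊕ twist y e) ⊕ twist x (carry y w)
        ≡⟨ cong₂ _⊕_ (twist-homo x c _) (twist-carry x y w) ⟩
      (twist x c ⊕ twist x (twist y e)) ⊕ carry y w
        ≡⟨ cong (λ t → (twist x c ⊕ t) ⊕ carry y w) (twist-xor x y e) ⟩
      (twist x c ⊕ twist (x xor y) e) ⊕ carry y w
        ∎
    first-coords : (A ⊕ twist (x xor y) e) ⊕ carry (x xor y) w ≡ (a ⊕ twist x C) ⊕ carry x (y xor w)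
    first-coords = begin
      (((a ⊕ twist x c) ⊕ carry x y) ⊕ twist (x xor y) e) ⊕ carry (x xor y) w
        ≡⟨ solve 5 (λ a c e p q → (((a ⊞ c) ⊞ p) ⊞ e) ⊞ q ⊜ ((a ⊞ c) ⊞ e) ⊞ (p ⊞ q)) refl
             a (twist x c) (twist (x xor y) e) (carry x y) (carry (x xor y) w) ⟩
      ((a ⊕ twist x c) ⊕ twist (x xor y) e) ⊕ (carry x y ⊕ carry (x xor y) w)
        ≡⟨ cong (((a ⊕ twist x c) ⊕ twist (x xor y) e) ⊕_) (carry-cocycle x y w) ⟩
      ((a ⊕ twist x c) ⊕ twist (x xor y) e) ⊕ (carry y w ⊕ carry x (y xor w))
        ≡⟨ solve 5 (λ a c e p q → ((a ⊞ c) ⊞ e) ⊞ (p ⊞ q) ⊜ (a ⊞ ((c ⊞ e) ⊞ p)) ⊞ q) refl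
             a (twist x c) (twist (x xor y) e) (carry y w) (carry x (y xor w)) ⟩
      (a ⊕ ((twist x c ⊕ twist (x xor y) e) ⊕ carry y w)) ⊕ carry x (y xor w)
        ≡⟨ cong (λ t → (a ⊕ t) ⊕ carry x (y xor w)) twist-C ⟨
      (a ⊕ twist x C) ⊕ carry x (y xor w)
        ∎

  mul-identityˡ : ∀ g → one n · g ≡ g
  mul-identityˡ (c , y) = cong (_, y) (addZ-identityˡ c)

  mul-identityʳ : ∀ g → g · one n ≡ g
  mul-identityʳ (a , false) = cong (_, false) (⊕-identityʳ a)
  mul-identityʳ (a , true)  = cong (_, true) (trans (cong (a ⊕_) ε⁻¹≈ε) (⊕-identityʳ a))

  nZ-cancel : ∀ a → (a ⊕ nZ n) ⊕ nZ n ≡ a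
  nZ-cancel a = begin
    (a ⊕ nZ n) ⊕ nZ n  ≡⟨ solve 2 (λ a z → (a ⊞ z) ⊞ z ⊜ a ⊞ (z ⊞ z)) refl a (nZ n) ⟩
    a ⊕ (nZ n ⊕ nZ n)  ≡⟨ cong (a ⊕_) nZ+nZ≡0 ⟩
    a ⊕ 0ᶻ             ≡⟨ ⊕-identityʳ a ⟩
    a                  ∎
    where open ≡-Reasoning

  mul-inverseˡ : ∀ g → inv n g · g ≡ one n
  mul-inverseˡ (a , false) = cong (_, false) (⊖-inverseˡ a)
  mul-inverseˡ (a , true)  = cong (_, false) (begin
    ((a ⊕ nZ n) ⊕ ⊖ a) ⊕ nZ n
      ≡⟨ solve 3 (λ a z b → ((a ⊞ z) ⊞ b) ⊞ z ⊜ ((a ⊞ b) ⊞ z) ⊞ z) refl a (nZ n) (⊖ a) ⟩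
    ((a ⊕ ⊖ a) ⊕ nZ n) ⊕ nZ n
      ≡⟨ nZ-cancel (a ⊕ ⊖ a) ⟩
    a ⊕ ⊖ a
      ≡⟨ ⊖-inverseʳ a ⟩
    0ᶻ
      ∎)
    where open ≡-Reasoning

  inv-involutive : ∀ g → inv n (inv n g) ≡ g
  inv-involutive (a , false) = cong (_, false) (⁻¹-involutive a)
  inv-involutive (a , true)  = cong (_, true) (nZ-cancel a)

  mul-inverseʳ : ∀ g → g · inv n g ≡ one n
  mul-inverseʳ g = subst (λ h → h · inv n g ≡ one n) (inv-involutive g) (mul-inverseˡ (inv n g))

  isGroup : IsGroup _≡_ (mul n) (one n) (inv n)
  isGroup = record
    { isMonoid = record
      { isSemigroup = record
        { isMagma = record { isEquivalence = isEquivalence ; ∙-cong = cong₂ (mul n) }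
        ; assoc = mul-assoc
        }
      ; identity = mul-identityˡ , mul-identityʳ
      }
    ; inverse = mul-inverseˡ , mul-inverseʳ
    ; ⁻¹-cong = cong (inv n)
    }

  group : Group _ _
  group = record { isGroup = isGroup }

  αⁿ : Dic n
  αⁿ = nZ n , false

  αⁿ≢one : αⁿ ≢ one n
  αⁿ≢one eq = nZ≢0 (cong proj₁ eq)

  αⁿ-square : αⁿ · αⁿ ≡ one n
  αⁿ-square = cong (_, false) nZ+nZ≡0

  reflection-square : ∀ k → (k , true) · (k , true) ≡ αⁿ
  reflection-square k = cong (_, false) (trans (cong (_⊕ nZ n) (⊖-inverseʳ k)) (addZ-identityˡ (nZ n)))

  reflection-inverse : ∀ k → inv n (k , true) ≡ (k , true) · αⁿ
  reflection-inverse k = cong (λ t → (k ⊕ t , true)) (sym ⊖nZ≡nZ)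

  rotations-commute : ∀ a c → (a , false) · (c , false) ≡ (c , false) · (a , false)
  rotations-commute a c = cong (_, false) (⊕-comm a c)

  reflection-conjugates : ∀ a k → (a , false) · (k , true) ≡ (k , true) · inv n (a , false)
  reflection-conjugates a k = cong (_, true) (trans (⊕-comm a k) (cong (k ⊕_) (sym (⁻¹-involutive a))))

  αⁿ-central : ∀ g → αⁿ · g ≡ g · αⁿ
  αⁿ-central (c , false) = cong (_, false) (⊕-comm (nZ n) c)
  αⁿ-central (c , true)  = cong (_, true) (trans (⊕-comm (nZ n) c) (cong (c ⊕_) (sym ⊖nZ≡nZ)))

  rotation-square-roots : ∀ p u → (p , false) · (p , false) ≡ (u , false) · (u , false) →
    (p , false) ≡ (u , false) ⊎ (p , false) ≡ (u , false) · αⁿ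
  rotation-square-roots p u eq =
    Sum.map (λ d≡0 → cong (_, false) (p≡d+u 0ᶻ d≡0 (addZ-identityˡ u)))
            (λ d≡n → cong (_, false) (p≡d+u (nZ n) d≡n (⊕-comm (nZ n) u)))
            (double≡0 d d+d≡0)
    where
    open ≡-Reasoning
    d = p ⊕ ⊖ u
    d+d≡0 : d ⊕ d ≡ 0ᶻ
    d+d≡0 = begin
      (p ⊕ ⊖ u) ⊕ (p ⊕ ⊖ u)  ≡⟨ solve 2 (λ p v → (p ⊞ v) ⊞ (p ⊞ v) ⊜ (p ⊞ p) ⊞ (v ⊞ v)) refl p (⊖ u) ⟩
      (p ⊕ p) ⊕ (⊖ u ⊕ ⊖ u)  ≡⟨ cong₂ _⊕_ (cong proj₁ eq) (⁻¹-∙-comm u u) ⟩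
      (u ⊕ u) ⊕ ⊖ (u ⊕ u)    ≡⟨ ⊖-inverseʳ (u ⊕ u) ⟩
      0ᶻ                     ∎
    p≡d+u : ∀ c {r} → d ≡ c → c ⊕ u ≡ r → p ≡ r
    p≡d+u c d≡c c+u≡r = trans (sym (//-rightDividesˡ u p)) (trans (cong (_⊕ u) d≡c) c+u≡r)

module DicyclicGroup (n : ℕ) .{{_ : NonZero n}} where

  open Dicyclic n
  open Group group using (_⁻¹; ε; assoc; identityʳ)
  open GroupProperties group
    using (⁻¹-anti-homo-∙; ⁻¹-involutive; \\-leftDividesˡ; //-rightDividesˡ; //-rightDividesʳ; ∙-cancelˡ)

  reflection⁻¹·αⁿ : ∀ q → (q , true) ⁻¹ · αⁿ ≡ (q , true)
  reflection⁻¹·αⁿ q = begin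
    (q , true) ⁻¹ · αⁿ         ≡⟨ cong (_· αⁿ) (reflection-inverse q) ⟩
    ((q , true) · αⁿ) · αⁿ     ≡⟨ assoc (q , true) αⁿ αⁿ ⟩
    (q , true) · (αⁿ · αⁿ)     ≡⟨ cong ((q , true) ·_) αⁿ-square ⟩
    (q , true) · ε             ≡⟨ identityʳ (q , true) ⟩
    (q , true)                 ∎
    where open ≡-Reasoning

  reflection-quotients : ∀ k q → (k , true) · (q , true) ⁻¹ ≡ (k , true) ⁻¹ · (q , true)
  reflection-quotients k q = begin
    x · w ⁻¹         ≡⟨ cong (x ·_) (reflection-inverse q) ⟩
    x · (w · αⁿ)     ≡⟨ cong (x ·_) (αⁿ-central w) ⟨
    x · (αⁿ · w)     ≡⟨ assoc x αⁿ w ⟨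
    (x · αⁿ) · w     ≡⟨ cong (_· w) (reflection-inverse k) ⟨
    x ⁻¹ · w         ∎
    where
    open ≡-Reasoning
    x = (k , true)
    w = (q , true)

  reflectionPairing : Zmod n → Dic n → Dic n
  reflectionPairing k (p , false) = (p , false) ⁻¹ · (k , true)
  reflectionPairing k (q , true)  = (k , true) · (q , true) ⁻¹

  rotationPairing : Zmod n → Dic n → Dic n
  rotationPairing t (p , false) = (t , false) · (p , false) ⁻¹
  rotationPairing t (q , true)  = (q , true) · αⁿ

  ⁻¹-of-left-quotient : ∀ w x → (w ⁻¹ · x) ⁻¹ ≡ x ⁻¹ · w
  ⁻¹-of-left-quotient w x = trans (⁻¹-anti-homo-∙ (w ⁻¹) x) (cong (x ⁻¹ ·_) (⁻¹-involutive w))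

  ⁻¹-of-right-quotient : ∀ x w → (x · w ⁻¹) ⁻¹ ≡ w · x ⁻¹
  ⁻¹-of-right-quotient x w = trans (⁻¹-anti-homo-∙ x (w ⁻¹)) (cong (_· x ⁻¹) (⁻¹-involutive w))

  reflectionPairing-involutive : ∀ k w → reflectionPairing k (reflectionPairing k w) ≡ w
  reflectionPairing-involutive k (p , false) =
    trans (cong ((k , true) ·_) (⁻¹-of-left-quotient (p , false) (k , true)))
          (\\-leftDividesˡ (k , true) (p , false))
  reflectionPairing-involutive k (q , true) =
    trans (cong (_· (k , true)) (⁻¹-of-right-quotient (k , true) (q , true)))
          (//-rightDividesˡ (k , true) (q , true))

  reflectionPairing-fixedPointFree : ∀ k w → reflectionPairing k w ≢ w
  reflectionPairing-fixedPointFree k (p , false) eq with () ← cong proj₂ eq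
  reflectionPairing-fixedPointFree k (q , true)  eq with () ← cong proj₂ eq

  rotationPairing-involutive : ∀ t w → rotationPairing t (rotationPairing t w) ≡ w
  rotationPairing-involutive t (p , false) = begin
    x · (x · w ⁻¹) ⁻¹  ≡⟨ cong (x ·_) (⁻¹-of-right-quotient x w) ⟩
    x · (w · x ⁻¹)     ≡⟨ cong (x ·_) (rotations-commute p (negZ n t)) ⟩
    x · (x ⁻¹ · w)     ≡⟨ \\-leftDividesˡ x w ⟩
    w                  ∎
    where
    open ≡-Reasoning
    x = (t , false)
    w = (p , false)
  rotationPairing-involutive t (q , true) = trans (sym (cong (_· αⁿ) (reflection-inverse q))) (reflection⁻¹·αⁿ q)

  rotationPairing-fixes-root : ∀ u → rotationPairing (addZ n u u) (u , false) ≡ (u , false)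
  rotationPairing-fixes-root u = //-rightDividesʳ (u , false) (u , false)

  rotationPairing-fixedPoints : ∀ u w → rotationPairing (addZ n u u) w ≡ w →
    w ≡ (u , false) ⊎ w ≡ (u , false) · αⁿ
  rotationPairing-fixedPoints u (p , false) fixed = rotation-square-roots p u (sym (begin
    (u , false) · (u , false)              ≡⟨ //-rightDividesˡ (p , false) (addZ n u u , false) ⟨
    ((u , false) · (u , false) · (p , false) ⁻¹) · (p , false)  ≡⟨ cong (_· (p , false)) fixed ⟩
    (p , false) · (p , false)              ∎))
    where open ≡-Reasoning
  rotationPairing-fixedPoints u (q , true) fixed =
    ⊥-elim (αⁿ≢one (∙-cancelˡ (q , true) αⁿ ε (trans fixed (sym (identityʳ (q , true))))))

module CayleyGraphOnDic (n : ℕ) .{{_ : NonZero n}} (S : Dic n → Set)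
  (S-irreflexive : ¬ S (one n)) (S-symmetric : ∀ g → S g → S (inv n g)) where

  open ℤ/2n n using (double≡0)
  open Dicyclic n
  open DicyclicGroup n
  open Group group using (_⁻¹; ε; assoc; identityˡ; identityʳ; inverseˡ)
  open GroupProperties group using (⁻¹-anti-homo-∙; ⁻¹-involutive; ε⁻¹≈ε; \\-leftDividesˡ; \\-leftDividesʳ)

  infix 4 _~_

  _~_ : Dic n → Dic n → Set
  _~_ = CayAdj n S

  open GraphDistance _~_

  _≟_ : DecidableEquality (Dic n)
  _≟_ = ≡-dec Fin._≟_ Bool._≟_

  translate : ∀ g {u v} → u ~ v → g · u ~ g · v
  translate g {u} {v} = subst S (sym (begin
    (g · u) ⁻¹ · (g · v)     ≡⟨ cong (_· (g · v)) (⁻¹-anti-homo-∙ g u) ⟩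
    (u ⁻¹ · g ⁻¹) · (g · v)  ≡⟨ assoc (u ⁻¹) (g ⁻¹) (g · v) ⟩
    u ⁻¹ · (g ⁻¹ · (g · v))  ≡⟨ cong (u ⁻¹ ·_) (\\-leftDividesʳ g v) ⟩
    u ⁻¹ · v                 ∎))
    where open ≡-Reasoning

  Dist-translate : ∀ g {u v i} → Dist _~_ u v i → Dist _~_ (g · u) (g · v) i
  Dist-translate g = Dist-map (g ·_) (g ⁻¹ ·_) (translate g) (translate (g ⁻¹)) (\\-leftDividesʳ g)

  ε⁻¹· : ∀ w → ε ⁻¹ · w ≡ w
  ε⁻¹· w = trans (cong (_· w) ε⁻¹≈ε) (identityˡ w)

  S⇒ε~ : ∀ {w} → S w → ε ~ w
  S⇒ε~ {w} = subst S (sym (ε⁻¹· w))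

  ε~⇒S : ∀ {w} → ε ~ w → S w
  ε~⇒S {w} = subst S (ε⁻¹· w)

  S⇒Dist1 : ∀ {w} → S w → Dist _~_ ε w 1
  S⇒Dist1 Sw = step (S⇒ε~ Sw) here , λ where
    zero p    → ⊥-elim (S-irreflexive (subst S (sym (Walk-length-0 p)) Sw))
    (suc _) _ → s≤s z≤n

  Dist1⇒S : ∀ {w} → Dist _~_ ε w 1 → S w
  Dist1⇒S (step ε~w here , _) = ε~⇒S ε~w

  walk-via : ∀ {a w} → S a → a ~ w → Walk _~_ ε w 2
  walk-via Sa a~w = step (S⇒ε~ Sa) (step a~w here)

  CommonNeighbour : Dic n → Dic n → Set
  CommonNeighbour x w = x ~ w × S w

  a₁-set⇔CommonNeighbour : ∀ x w → (x ~ w × Dist _~_ ε w 1) ⇔ CommonNeighbour x w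
  a₁-set⇔CommonNeighbour x w = mk⇔ (λ (x~w , D) → x~w , Dist1⇒S D) (λ (x~w , Sw) → x~w , S⇒Dist1 Sw)

  c₂-set⇔CommonNeighbour : ∀ x w → (x ~ w × Dist _~_ ε w (2 ∸ 1) × 1 ≤ 2) ⇔ CommonNeighbour x w
  c₂-set⇔CommonNeighbour x w =
    mk⇔ (λ (x~w , D , _) → x~w , Dist1⇒S D) (λ (x~w , Sw) → x~w , S⇒Dist1 Sw , s≤s z≤n)

  reflectionPairing-closed : ∀ k w → CommonNeighbour (k , true) w →
    CommonNeighbour (k , true) (reflectionPairing k w)
  reflectionPairing-closed k (p , false) (x~w , Sw) =
    subst S (sym x⁻¹w⁻¹x≡w) Sw , subst S (⁻¹-of-left-quotient (k , true) (p , false)) (S-symmetric _ x~w)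
    where
    x⁻¹w⁻¹x≡w : (k , true) ⁻¹ · ((p , false) ⁻¹ · (k , true)) ≡ (p , false)
    x⁻¹w⁻¹x≡w = begin
      x ⁻¹ · (w ⁻¹ · x)      ≡⟨ cong (x ⁻¹ ·_) (reflection-conjugates (negZ n p) k) ⟩
      x ⁻¹ · (x · w ⁻¹ ⁻¹)   ≡⟨ \\-leftDividesʳ x (w ⁻¹ ⁻¹) ⟩
      w ⁻¹ ⁻¹                ≡⟨ ⁻¹-involutive w ⟩
      w                      ∎
      where
      open ≡-Reasoning
      x = (k , true)
      w = (p , false)
  reflectionPairing-closed k (q , true) (x~w , Sw) =
    subst S (sym (\\-leftDividesʳ (k , true) ((q , true) ⁻¹))) (S-symmetric _ Sw) ,
    subst S (sym (reflection-quotients k q)) x~w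

  rotationPairing-closed : ∀ t w → CommonNeighbour (t , false) w →
    CommonNeighbour (t , false) (rotationPairing t w)
  rotationPairing-closed t (p , false) (x~w , Sw) =
    subst S (sym (\\-leftDividesʳ (t , false) ((p , false) ⁻¹))) (S-symmetric _ Sw) ,
    subst S (trans (cong _⁻¹ (rotations-commute (negZ n t) p)) (⁻¹-of-right-quotient (p , false) (t , false)))
      (S-symmetric _ x~w)
  rotationPairing-closed t (q , true) (x~w , Sw) =
    subst S (trans (reflection-inverse (addZ n (negZ n t) q)) (assoc ((t , false) ⁻¹) (q , true) αⁿ))
      (S-symmetric _ x~w) ,
    subst S (reflection-inverse q) (S-symmetric _ Sw)

  reflection-count-even : ∀ k {P : Dic n → Set} {c} → HasCard _~_ P c →
    (∀ w → P w ⇔ CommonNeighbour (k , true) w) → 2 ∣ c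
  reflection-count-even k count P⇔ =
    InvolutionParity.HasCard-even _≟_ (reflectionPairing k) (reflectionPairing-involutive k) {_~_} count
      (λ w Pw → Equivalence.from (P⇔ _) (reflectionPairing-closed k w (Equivalence.to (P⇔ w) Pw)))
      (λ w _ → reflectionPairing-fixedPointFree k w)

  rotation-count-odd : ∀ u → S (u , false) → ¬ S ((u , false) · αⁿ) → ∀ {P : Dic n → Set} {c} →
    HasCard _~_ P c → (∀ w → P w ⇔ CommonNeighbour ((u , false) · (u , false)) w) → ¬ 2 ∣ c
  rotation-count-odd u Su ¬Suαⁿ {P} count P⇔ =
    InvolutionParity.HasCard-odd _≟_ (rotationPairing t) (rotationPairing-involutive t) {_~_} count
      (λ w Pw → Equivalence.from (P⇔ _) (rotationPairing-closed t w (Equivalence.to (P⇔ w) Pw)))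
      (Equivalence.from (P⇔ _) (subst S (sym [uu]⁻¹u≡u⁻¹) (S-symmetric _ Su) , Su))
      (rotationPairing-fixes-root u)
      (λ w Pw fixed → Sum.[ id , (λ w≡uαⁿ → ⊥-elim (¬Suαⁿ (subst S w≡uαⁿ (S-of w Pw)))) ]
                        (rotationPairing-fixedPoints u w fixed))
    where
    open ≡-Reasoning
    t = addZ n u u
    S-of : ∀ w → P w → S w
    S-of w Pw = proj₂ (Equivalence.to (P⇔ w) Pw)
    [uu]⁻¹u≡u⁻¹ : ((u , false) · (u , false)) ⁻¹ · (u , false) ≡ (u , false) ⁻¹
    [uu]⁻¹u≡u⁻¹ = begin
      (r · r) ⁻¹ · r        ≡⟨ cong (_· r) (⁻¹-anti-homo-∙ r r) ⟩
      (r ⁻¹ · r ⁻¹) · r     ≡⟨ assoc (r ⁻¹) (r ⁻¹) r ⟩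
      r ⁻¹ · (r ⁻¹ · r)     ≡⟨ cong (r ⁻¹ ·_) (inverseˡ r) ⟩
      r ⁻¹ · ε              ≡⟨ identityʳ (r ⁻¹) ⟩
      r ⁻¹                  ∎
      where r = (u , false)

  module AntipodalDiameter3
    (connected : Connected _~_) (antipodal : Antipodal _~_ 3)
    (bounded : ∀ u v i → Dist _~_ u v i → i ≤ 3) (diametral : ∃ λ u → ∃ λ v → Dist _~_ u v 3)
    (c a b : ℕ → ℕ)
    (regular : ∀ u v i → Dist _~_ u v i →
      HasCard _~_ (λ w → v ~ w × Dist _~_ u w (i ∸ 1) × (1 ≤ i)) (c i) ×
      HasCard _~_ (λ w → v ~ w × Dist _~_ u w i) (a i) ×
      HasCard _~_ (λ w → v ~ w × Dist _~_ u w (suc i)) (b i)) where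

    far-from-ε : ∃ λ w → Dist _~_ ε w 3
    far-from-ε = let u , v , D = diametral in
      u ⁻¹ · v , subst (λ x → Dist _~_ x (u ⁻¹ · v) 3) (inverseˡ u) (Dist-translate (u ⁻¹) D)

    reflection-in-S : ∃ λ q → S (q , true)
    reflection-in-S =
      edge-into-coset (crossing-edge proj₂ (proj₁ (proj₂ (connected ε (mod n 0 , true)))) refl refl)
      where
      edge-into-coset : (∃₂ λ x y → x ~ y × proj₂ x ≡ false × proj₂ y ≡ true) → ∃ λ q → S (q , true)
      edge-into-coset ((_ , false) , (_ , true) , x~y , refl , refl) = _ , x~y

    walk-to-αⁿ : Walk _~_ ε αⁿ 2
    walk-to-αⁿ = let q , Sq = reflection-in-S in
      walk-via Sq (subst S (sym (reflection⁻¹·αⁿ q)) Sq)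

    αⁿ-not-at-distance-3 : ¬ Dist _~_ ε αⁿ 3
    αⁿ-not-at-distance-3 (_ , min) = <⇒≱ (n<1+n 2) (min 2 walk-to-αⁿ)

    reflection-not-at-distance-3 : ∀ k → ¬ Dist _~_ ε (k , true) 3
    reflection-not-at-distance-3 k D =
      Sum.[ (λ (p , _) → αⁿ≢one (sym (Walk-length-0 p))) , αⁿ-not-at-distance-3 ]
        (IsEquivalence.trans antipodal (inj₂ D) (inj₂ D′))
      where
      D′ : Dist _~_ (k , true) αⁿ 3
      D′ = subst₂ (λ x y → Dist _~_ x y 3) (identityʳ (k , true)) (reflection-square k)
             (Dist-translate (k , true) D)

    reflection-at-distance-2 : ¬ ¬ (∃ λ k → Dist _~_ ε (k , true) 2)
    -- Otherwise every reflection lies in S, and then every vertex is within distance 2 of ε.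
    reflection-at-distance-2 none = far-vertex-is-near far-from-ε
      where
      reflections-in-S : ∀ k → S (k , true)
      reflections-in-S k = at-distance-1 (connected ε (k , true))
        where
        at-distance-1 : (∃ λ i → Dist _~_ ε (k , true) i) → S (k , true)
        at-distance-1 (0 , p , _) = case cong proj₂ (Walk-length-0 p) of λ ()
        at-distance-1 (1 , D) = Dist1⇒S D
        at-distance-1 (2 , D) = ⊥-elim (none (k , D))
        at-distance-1 (3 , D) = ⊥-elim (reflection-not-at-distance-3 k D)
        at-distance-1 (suc (suc (suc (suc _))) , D) = case bounded _ _ _ D of λ { (s≤s (s≤s (s≤s ()))) }
      far-vertex-is-near : ¬ ∃ λ w → Dist _~_ ε w 3
      far-vertex-is-near ((t , true)  , D)       = reflection-not-at-distance-3 t D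
      far-vertex-is-near ((t , false) , _ , min) =
        <⇒≱ (n<1+n 2) (min 2 (walk-via (reflections-in-S (mod n 0)) (reflections-in-S _)))

    a₁-even : 2 ∣ a 1
    a₁-even = let q , Sq = reflection-in-S in
      reflection-count-even q (proj₁ (proj₂ (regular ε (q , true) 1 (S⇒Dist1 Sq))))
        (a₁-set⇔CommonNeighbour (q , true))

    c₂-even : ∀ {k} → Dist _~_ ε (k , true) 2 → 2 ∣ c 2
    c₂-even {k} D = reflection-count-even k (proj₁ (regular ε (k , true) 2 D)) (c₂-set⇔CommonNeighbour (k , true))

    rotation-shift : ∀ {k} → Dist _~_ ε (k , true) 2 →
      ∀ u → S (u , false) → (u , false) ≢ αⁿ → ¬ ¬ S ((u , false) · αⁿ)
    rotation-shift D-k u Su u≢αⁿ ¬Suαⁿ = distance-of-square (connected ε x)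
      where
      x = (u , false) · (u , false)
      distance-of-square : (∃ λ i → Dist _~_ ε x i) → ⊥
      distance-of-square (0 , p , _) =
        Sum.[ (λ u≡0 → S-irreflexive (subst (λ t → S (t , false)) u≡0 Su))
            , (λ u≡n → u≢αⁿ (cong (_, false) u≡n)) ]
          (double≡0 u (cong proj₁ (sym (Walk-length-0 p))))
      distance-of-square (1 , D) =
        rotation-count-odd u Su ¬Suαⁿ (proj₁ (proj₂ (regular ε x 1 D))) (a₁-set⇔CommonNeighbour x) a₁-even
      distance-of-square (2 , D) =
        rotation-count-odd u Su ¬Suαⁿ (proj₁ (regular ε x 2 D)) (c₂-set⇔CommonNeighbour x) (c₂-even D-k)
      distance-of-square (suc (suc (suc _)) , _ , min) = <⇒≱ (s≤s (s≤s (s≤s z≤n)))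
        (min 2 (walk-via Su (subst S (sym (\\-leftDividesʳ (u , false) (u , false))) Su)))

    αⁿ-neighbours-in-S : ∀ {k} → Dist _~_ ε (k , true) 2 → ∀ {w} → αⁿ ~ w → w ≢ ε → ¬ ¬ S w
    αⁿ-neighbours-in-S D-k {w} αⁿ~w w≢ε =
      subst (λ v → ¬ ¬ S v) (\\-leftDividesˡ αⁿ w)
        (αⁿ-times _ αⁿ~w (λ eq → w≢ε (trans (sym (\\-leftDividesˡ αⁿ w)) eq)))
      where
      αⁿ-times : ∀ t → S t → αⁿ · t ≢ ε → ¬ ¬ S (αⁿ · t)
      αⁿ-times (q , true) St _ ¬S =
        ¬S (subst S (trans (reflection-inverse q) (sym (αⁿ-central (q , true)))) (S-symmetric _ St))
      αⁿ-times (p , false) St αⁿt≢ε = by-cases ((p , false) ≟ αⁿ)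
        where
        by-cases : Dec ((p , false) ≡ αⁿ) → ¬ ¬ S (αⁿ · (p , false))
        by-cases (yes refl) = ⊥-elim (αⁿt≢ε αⁿ-square)
        by-cases (no p≢αⁿ)  = subst (λ v → ¬ ¬ S v) (sym (αⁿ-central (p , false))) (rotation-shift D-k p St p≢αⁿ)

    no-far-neighbour-of-αⁿ : ∀ {k} → Dist _~_ ε (k , true) 2 → ∀ {w i} → αⁿ ~ w → ¬ Dist _~_ ε w (2 + i)
    no-far-neighbour-of-αⁿ D-k {w} αⁿ~w D@(_ , min) = αⁿ-neighbours-in-S D-k αⁿ~w w≢ε ¬Sw
      where
      w≢ε : w ≢ ε
      w≢ε refl = case min 0 here of λ ()
      ¬Sw : ¬ S w
      ¬Sw Sw = case Dist-functional (S⇒Dist1 Sw) D of λ ()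

    αⁿ-at-distance-2 : ¬ S αⁿ → Dist _~_ ε αⁿ 2
    αⁿ-at-distance-2 ¬Sαⁿ = exactly-2 (connected ε αⁿ)
      where
      exactly-2 : (∃ λ i → Dist _~_ ε αⁿ i) → Dist _~_ ε αⁿ 2
      exactly-2 (0 , p , _) = ⊥-elim (αⁿ≢one (sym (Walk-length-0 p)))
      exactly-2 (1 , D) = ⊥-elim (¬Sαⁿ (Dist1⇒S D))
      exactly-2 (2 , D) = D
      exactly-2 (suc (suc (suc _)) , _ , min) = ⊥-elim (<⇒≱ (s≤s (s≤s (s≤s z≤n))) (min 2 walk-to-αⁿ))

    contradiction : ⊥
    contradiction = reflection-at-distance-2 λ (_ , D-k) → via-geodesic D-k far-from-ε
      where
      via-geodesic : ∀ {k} → Dist _~_ ε (k , true) 2 → ¬ ∃ λ w → Dist _~_ ε w 3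
      via-geodesic D-k (_ , D₃@(step ε~a₁ (step a₁~b₂ (step b₂~w₃ here)) , _)) =
        ¬Sαⁿ-impossible Sαⁿ-impossible
        where
        D-a₁ = S⇒Dist1 (ε~⇒S ε~a₁)
        D-b₂ = geodesic-prefix D₃ (step ε~a₁ (step a₁~b₂ here)) b₂~w₃
        Sαⁿ-impossible : ¬ S αⁿ
        Sαⁿ-impossible Sαⁿ =
          let _ , αⁿ~w , D = HasCard-inhabited (proj₂ (proj₂ (regular ε _ 1 D-a₁)))
                                               (proj₂ (proj₂ (regular ε αⁿ 1 (S⇒Dist1 Sαⁿ)))) (a₁~b₂ , D-b₂)
          in no-far-neighbour-of-αⁿ D-k αⁿ~w D
        ¬Sαⁿ-impossible : ¬ ¬ S αⁿ
        ¬Sαⁿ-impossible ¬Sαⁿ =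
          let _ , αⁿ~w , D = HasCard-inhabited (proj₂ (proj₂ (regular ε _ 2 D-b₂)))
                                               (proj₂ (proj₂ (regular ε αⁿ 2 (αⁿ-at-distance-2 ¬Sαⁿ)))) (b₂~w₃ , D₃)
          in no-far-neighbour-of-αⁿ D-k αⁿ~w D

lemma3p7 : (n : ℕ) → .{{_ : NonZero n}} → (S : Dic n → Set) →
    ¬ S (one n) → (∀ g → S g → S (inv n g)) →
    ¬ (DistanceRegular (CayAdj n S) × HasDiameter (CayAdj n S) 3 ×
       Antipodal (CayAdj n S) 3 × ¬ Bipartite (CayAdj n S))
lemma3p7 n S S-irreflexive S-symmetric
  ((connected , c , a , b , regular) , (_ , bounded , diametral) , antipodal , _) =
  AntipodalDiameter3.contradiction connected antipodal bounded diametral c a b regular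
  where open CayleyGraphOnDic n S S-irreflexive S-symmetric
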